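{- Let $n, s, t$ be positive integers. Let $S_1, \dots, S_s \subseteq [n]$ be non-empty pairwise disjoint subsets and $T_1, \dots, T_t \subseteq [n]$ be non-empty pairwise disjoint subsets such that: (1) $\bigcup_{p \in [s]} S_p = \bigcup_{q \in [t]} T_q = [n]$; (2) for any subsets $\theta_1 \subseteq [s]$ and $\theta_2 \subseteq [t]$, if $\bigcup_{p \in \theta_1} S_p = \bigcup_{q \in \theta_2} T_q = \Gamma$ for some $\Gamma \subseteq [n]$, then $\Gamma \in \{\emptyset, [n]\}$. Then there exist an integer $l \geq 2$ and a finite sequence of sets $L_1, \dots, L_l \in \{S_1, \dots, S_s\} \cup \{T_1, \dots, T_t\}$ such that: (i) $\bigcup_{p \in [l]} L_p = [n]$; and (ii) for all $p \in [l-1]$, $(L_1 \cup \dots \cup L_p) \cap L_{p+1} \neq \emptyset$.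
   Context: $[k]$ denotes $\{1,\dots,k\}$. -}

module Defs where

open import Data.Nat using (ℕ; zero; suc)
open import Data.Bool using (true; false)
open import Data.Fin using (Fin; zero; suc; toℕ)
open import Data.Vec using ([]; _∷_)
open import Data.Fin.Subset using (Subset; ⊥; _∪_)

⋃[_]_ : ∀ {k n} → Subset k → (Fin k → Subset n) → Subset n
⋃[ [] ] F = ⊥
⋃[ true ∷ θ ] F = F zero ∪ (⋃[ θ ] (λ i → F (suc i)))
⋃[ false ∷ θ ] F = ⋃[ θ ] (λ i → F (suc i))

-- prefixUnion L p = L₀ ∪ … ∪ L_p  (0-indexed; i.e. L_1 ∪ … ∪ L_{p+1} in 1-indexed terms)
prefixUnion : ∀ {l n} → (Fin l → Subset n) → Fin l → Subset n
prefixUnion L zero = L zero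
prefixUnion L (suc p) = L zero ∪ prefixUnion (λ i → L (suc i)) p

module Submission where

-- Call a sequence L₀, …, L_m of blocks (members of the two
-- partitions {S_p} and {T_q}) a chain when every L_{i+1} meets
-- L₀ ∪ … ∪ L_i.  Start with the chain S₀, T_q, where T_q is a block of the
-- second partition meeting S₀, and grow it greedily: as long as some block
-- X crosses the current union U (meets U without being contained in it),
-- append X.  The union then strictly grows, so the process stops after at
-- most n steps.  When no block crosses U, every block meeting U lies inside
-- U, hence U is simultaneously a union of S-blocks and a union of T-blocks;
-- hypothesis (2) and U ≠ ∅ force U = [n], and the chain is the sequence
-- required by the theorem.
--
-- Only the
-- covering property (1), hypothesis (2) and S₀ ≠ ∅ are needed.

open import Defs
open import Data.Nat using (ℕ; zero; suc; _≥_; _<_; _≤_; _+_)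
open import Data.Nat.Properties using (≤-trans; ≤-antisym; +-suc; +-monoʳ-≤; m≤m+n; n≤1+n; ≤-refl)
open import Data.Bool using (true; false)
open import Data.Fin using (Fin; zero; suc; inject₁; fromℕ)
open import Data.Fin.Properties using (any?)
open import Data.Fin.Subset using (Subset; ⊤; ⊥; _∩_; _∪_; _∈_; _∉_; _⊆_; ∣_∣; Nonempty; Empty)
open import Data.Fin.Subset.Properties
  using (_∈?_; _⊆?_; nonempty?; ∈⊤; ∉⊥; ⊆-antisym; x∈p∪q⁻; x∈p∪q⁺; x∈p∩q⁺;
         p⊆p∪q; q⊆p∪q; ∪-assoc; ∪-identityʳ; ∣p∣≤n; ∣p∣≡n⇒p≡⊤; p⊂q⇒∣p∣<∣q∣)
open import Data.Vec using ([]; _∷_; here; there)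
open import Data.Product using (Σ; ∃; ∃-syntax; _×_; _,_; proj₁; proj₂)
open import Data.Sum using (_⊎_; inj₁; inj₂)
open import Data.Empty using (⊥-elim)
open import Relation.Nullary using (Dec; yes; no; ¬_; does; ¬?)
open import Relation.Nullary.Decidable using (_×-dec_)
open import Relation.Binary.PropositionalEquality
  using (_≡_; _≢_; refl; sym; trans; cong; cong₂; subst)

∈-⋃⁻ : ∀ {k n} (θ : Subset k) (F : Fin k → Subset n) {x : Fin n} →
       x ∈ ⋃[ θ ] F → ∃ λ i → i ∈ θ × x ∈ F i
∈-⋃⁻ []          F x∈ = ⊥-elim (∉⊥ x∈)
∈-⋃⁻ (true ∷ θ)  F x∈ with x∈p∪q⁻ (F zero) (⋃[ θ ] (λ i → F (suc i))) x∈
... | inj₁ x∈F₀ = zero , here , x∈F₀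
... | inj₂ x∈⋃ with ∈-⋃⁻ θ (λ i → F (suc i)) x∈⋃
...   | i , i∈θ , x∈Fi = suc i , there i∈θ , x∈Fi
∈-⋃⁻ (false ∷ θ) F x∈ with ∈-⋃⁻ θ (λ i → F (suc i)) x∈
... | i , i∈θ , x∈Fi = suc i , there i∈θ , x∈Fi

∈-⋃⁺ : ∀ {k n} (θ : Subset k) (F : Fin k → Subset n) {x : Fin n} (i : Fin k) →
       i ∈ θ → x ∈ F i → x ∈ ⋃[ θ ] F
∈-⋃⁺ (true ∷ θ)  F zero    here        x∈Fi = x∈p∪q⁺ (inj₁ x∈Fi)
∈-⋃⁺ (true ∷ θ)  F (suc i) (there i∈θ) x∈Fi = x∈p∪q⁺ (inj₂ (∈-⋃⁺ θ (λ j → F (suc j)) i i∈θ x∈Fi))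
∈-⋃⁺ (false ∷ θ) F (suc i) (there i∈θ) x∈Fi = ∈-⋃⁺ θ (λ j → F (suc j)) i i∈θ x∈Fi

covers : ∀ {k n} (F : Fin k → Subset n) → ⋃[ ⊤ ] F ≡ ⊤ → ∀ x → ∃ λ i → x ∈ F i
covers F ⋃F≡⊤ x with ∈-⋃⁻ ⊤ F (subst (x ∈_) (sym ⋃F≡⊤) ∈⊤)
... | i , _ , x∈Fi = i , x∈Fi

select : ∀ {k} {P : Fin k → Set} → (∀ i → Dec (P i)) → Subset k
select {zero}  P? = []
select {suc k} P? = does (P? zero) ∷ select (λ i → P? (suc i))

∈-select⁻ : ∀ {k} {P : Fin k → Set} (P? : ∀ i → Dec (P i)) i → i ∈ select P? → P i
∈-select⁻ P? zero i∈ with P? zero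
∈-select⁻ P? zero here | yes Pi = Pi
∈-select⁻ P? (suc i) (there i∈) = ∈-select⁻ (λ j → P? (suc j)) i i∈

∈-select⁺ : ∀ {k} {P : Fin k → Set} (P? : ∀ i → Dec (P i)) i → P i → i ∈ select P?
∈-select⁺ P? zero Pi with P? zero
... | yes _  = here
... | no ¬Pi = ⊥-elim (¬Pi Pi)
∈-select⁺ P? (suc i) Pi = there (∈-select⁺ (λ j → P? (suc j)) i Pi)

snoc : ∀ {A : Set} m → (Fin (suc m) → A) → A → Fin (suc (suc m)) → A
snoc m       L x zero       = L zero
snoc zero    L x (suc zero) = x
snoc (suc m) L x (suc i)    = snoc m (λ j → L (suc j)) x i

snoc-inject₁ : ∀ {A : Set} m (L : Fin (suc m) → A) x i → snoc m L x (inject₁ i) ≡ L i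
snoc-inject₁ zero    L x zero    = refl
snoc-inject₁ (suc m) L x zero    = refl
snoc-inject₁ (suc m) L x (suc i) = snoc-inject₁ m (λ j → L (suc j)) x i

snoc-last : ∀ {A : Set} m (L : Fin (suc m) → A) x → snoc m L x (fromℕ (suc m)) ≡ x
snoc-last zero    L x = refl
snoc-last (suc m) L x = snoc-last m (λ j → L (suc j)) x

data Position : ∀ {m} → Fin (suc m) → Set where
  old  : ∀ {m} (q : Fin m) → Position (inject₁ q)
  last : ∀ {m} → Position (fromℕ m)

position : ∀ m (i : Fin (suc m)) → Position i
position zero    zero    = last
position (suc m) zero    = old zero
position (suc m) (suc i) with position m i
... | old q = old (suc q)
... | last  = last

snoc-all : ∀ {A : Set} (P : A → Set) m (L : Fin (suc m) → A) x →
           (∀ j → P (L j)) → P x → ∀ i → P (snoc m L x i)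
snoc-all P m L x PL Px i with position (suc m) i
... | old q = subst P (sym (snoc-inject₁ m L x q)) (PL q)
... | last  = subst P (sym (snoc-last m L x)) Px

prefixUnion-snoc-old : ∀ {n} m (L : Fin (suc m) → Subset n) x p →
                       prefixUnion (snoc m L x) (inject₁ p) ≡ prefixUnion L p
prefixUnion-snoc-old zero    L x zero    = refl
prefixUnion-snoc-old (suc m) L x zero    = refl
prefixUnion-snoc-old (suc m) L x (suc p) = cong (L zero ∪_) (prefixUnion-snoc-old m (λ j → L (suc j)) x p)

prefixUnion-snoc-last : ∀ {n} m (L : Fin (suc m) → Subset n) x →
                        prefixUnion (snoc m L x) (fromℕ (suc m)) ≡ prefixUnion L (fromℕ m) ∪ x
prefixUnion-snoc-last zero    L x = refl
prefixUnion-snoc-last (suc m) L x =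
  trans (cong (L zero ∪_) (prefixUnion-snoc-last m (λ j → L (suc j)) x))
        (sym (∪-assoc (L zero) _ x))

⋃⊤≡prefixUnion-last : ∀ {n} m (L : Fin (suc m) → Subset n) → ⋃[ ⊤ ] L ≡ prefixUnion L (fromℕ m)
⋃⊤≡prefixUnion-last zero    L = ∪-identityʳ (L zero)
⋃⊤≡prefixUnion-last (suc m) L = cong (L zero ∪_) (⋃⊤≡prefixUnion-last m (λ j → L (suc j)))

Connected : ∀ {n} m → (Fin (suc m) → Subset n) → Set
Connected m L = ∀ (p : Fin m) → Nonempty (prefixUnion L (inject₁ p) ∩ L (suc p))

snoc-connected : ∀ {n} m (L : Fin (suc m) → Subset n) x → Connected m L →
                 Nonempty (prefixUnion L (fromℕ m) ∩ x) → Connected (suc m) (snoc m L x)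
snoc-connected m L x conn meets p with position m p
... | old q = subst Nonempty (cong₂ _∩_ (sym (prefixUnion-snoc-old m L x (inject₁ q)))
                                        (sym (snoc-inject₁ m L x (suc q))))
                             (conn q)
... | last  = subst Nonempty (cong₂ _∩_ (sym (prefixUnion-snoc-old m L x (fromℕ m)))
                                        (sym (snoc-last m L x)))
                             meets

Crosses : ∀ {n} → Subset n → Subset n → Set
Crosses U X = Nonempty (U ∩ X) × ∃ λ x → x ∈ X × x ∉ U

crosses? : ∀ {n} (U X : Subset n) → Dec (Crosses U X)
crosses? U X = nonempty? (U ∩ X) ×-dec any? (λ x → (x ∈? X) ×-dec ¬? (x ∈? U))

crossing-grows : ∀ {n} (U X : Subset n) → Crosses U X → ∣ U ∣ < ∣ U ∪ X ∣
crossing-grows U X (_ , x , x∈X , x∉U) = p⊂q⇒∣p∣<∣q∣ (p⊆p∪q X , x , q⊆p∪q U X x∈X , x∉U)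

uncrossed⇒union : ∀ {k n} (F : Fin k → Subset n) → ⋃[ ⊤ ] F ≡ ⊤ → (U : Subset n) →
                  ¬ (∃ λ i → Crosses U (F i)) → ⋃[ select (λ i → F i ⊆? U) ] F ≡ U
uncrossed⇒union F ⋃F≡⊤ U uncrossed = ⊆-antisym union⊆U U⊆union
  where
  inside : Subset _
  inside = select (λ i → F i ⊆? U)

  union⊆U : ⋃[ inside ] F ⊆ U
  union⊆U x∈ with ∈-⋃⁻ inside F x∈
  ... | i , i∈ , x∈Fi = ∈-select⁻ (λ i → F i ⊆? U) i i∈ x∈Fi

  meeting⇒inside : ∀ {x} i → x ∈ U → x ∈ F i → F i ⊆ U
  meeting⇒inside {x} i x∈U x∈Fi {y} y∈Fi with y ∈? U
  ... | yes y∈U = y∈U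
  ... | no  y∉U = ⊥-elim (uncrossed (i , (x , x∈p∩q⁺ (x∈U , x∈Fi)) , y , y∈Fi , y∉U))

  U⊆union : U ⊆ ⋃[ inside ] F
  U⊆union {x} x∈U with covers F ⋃F≡⊤ x
  ... | i , x∈Fi = ∈-⋃⁺ inside F i (∈-select⁺ (λ i → F i ⊆? U) i (meeting⇒inside i x∈U x∈Fi)) x∈Fi

module Chains {n : ℕ} (Admissible : Subset n → Set) where

  record Chain (m : ℕ) : Set where
    field
      blocks     : Fin (suc m) → Subset n
      admissible : ∀ i → Admissible (blocks i)
      connected  : Connected m blocks

    union : Subset n
    union = prefixUnion blocks (fromℕ m)

  open Chain public

  extend : ∀ {m} (C : Chain m) X → Admissible X → Nonempty (union C ∩ X) → Chain (suc m)
  extend {m} C X adm meets = record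
    { blocks     = snoc m (blocks C) X
    ; admissible = snoc-all Admissible m (blocks C) X (admissible C) adm
    ; connected  = snoc-connected m (blocks C) X (connected C) meets
    }

  union-extend : ∀ {m} (C : Chain m) X adm meets → union (extend C X adm meets) ≡ union C ∪ X
  union-extend {m} C X _ _ = prefixUnion-snoc-last m (blocks C) X

  extend-nonempty : ∀ {m} (C : Chain m) X adm meets →
                    Nonempty (union C) → Nonempty (union (extend C X adm meets))
  extend-nonempty C X adm meets (x , x∈U) =
    x , subst (x ∈_) (sym (union-extend C X adm meets)) (p⊆p∪q X x∈U)

  extend-bound : ∀ {m} k (C : Chain m) X adm meets → Crosses (union C) X →
                 n ≤ suc k + ∣ union C ∣ → n ≤ k + ∣ union (extend C X adm meets) ∣
  extend-bound k C X adm meets crossing bound =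
    subst (λ V → n ≤ k + ∣ V ∣) (sym (union-extend C X adm meets))
      (≤-trans bound (subst (_≤ k + ∣ union C ∪ X ∣) (+-suc k ∣ union C ∣)
                        (+-monoʳ-≤ k (crossing-grows (union C) X crossing))))

  -- The fuel k
  -- bounds the number of points outside the union.
  grow : (∀ U → Nonempty U → U ≡ ⊤ ⊎ ∃ λ X → Admissible X × Crosses U X) →
         ∀ k {m} (C : Chain m) → Nonempty (union C) → n ≤ k + ∣ union C ∣ →
         ∃ λ m′ → m ≤ m′ × Σ (Chain m′) λ C′ → union C′ ≡ ⊤
  grow step zero    C _  n≤∣U∣ = _ , ≤-refl , C , ∣p∣≡n⇒p≡⊤ (≤-antisym (∣p∣≤n (union C)) n≤∣U∣)
  grow step (suc k) C ne bound with step (union C) ne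
  ... | inj₁ U≡⊤ = _ , ≤-refl , C , U≡⊤
  ... | inj₂ (X , adm , crossing@(meets , _)) =
    let m′ , sm≤m′ , result = grow step k (extend C X adm meets)
                                (extend-nonempty C X adm meets ne)
                                (extend-bound k C X adm meets crossing bound)
    in m′ , ≤-trans (n≤1+n _) sm≤m′ , result

module TwoCovers {n s t : ℕ} (S : Fin s → Subset n) (T : Fin t → Subset n)
  (coverS : ⋃[ ⊤ ] S ≡ ⊤) (coverT : ⋃[ ⊤ ] T ≡ ⊤)
  (trivialCommonUnions : ∀ (θ₁ : Subset s) (θ₂ : Subset t) (Γ : Subset n) →
     ⋃[ θ₁ ] S ≡ Γ → ⋃[ θ₂ ] T ≡ Γ → (Γ ≡ ⊥ ⊎ Γ ≡ ⊤)) where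

  Block : Subset n → Set
  Block X = (∃[ p ] X ≡ S p) ⊎ (∃[ q ] X ≡ T q)

  open Chains Block public

  -- Every nonempty U is [n] or is crossed by some block: otherwise U is a
  -- union of S-blocks and of T-blocks at the same time.
  whole-or-crossed : ∀ U → Nonempty U → U ≡ ⊤ ⊎ ∃ λ X → Block X × Crosses U X
  whole-or-crossed U (x , x∈U) with any? (λ p → crosses? U (S p)) | any? (λ q → crosses? U (T q))
  ... | yes (p , crossing) | _                  = inj₂ (S p , inj₁ (p , refl) , crossing)
  ... | no _               | yes (q , crossing) = inj₂ (T q , inj₂ (q , refl) , crossing)
  ... | no uncrossedS      | no uncrossedT
    with trivialCommonUnions (select (λ p → S p ⊆? U)) (select (λ q → T q ⊆? U)) U
           (uncrossed⇒union S coverS U uncrossedS) (uncrossed⇒union T coverT U uncrossedT)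
  ...   | inj₁ U≡⊥ = ⊥-elim (∉⊥ (subst (x ∈_) U≡⊥ x∈U))
  ...   | inj₂ U≡⊤ = inj₁ U≡⊤

  spanning-chain : ∀ p {x} → x ∈ S p → ∃ λ m → 1 ≤ m × Σ (Chain m) λ C → union C ≡ ⊤
  spanning-chain p {x} x∈Sp = grow whole-or-crossed n start (x , p⊆p∪q (T q) x∈Sp) (m≤m+n n _)
    where
    q : Fin t
    q = proj₁ (covers T coverT x)

    x∈Tq : x ∈ T q
    x∈Tq = proj₂ (covers T coverT x)

    start : Chain 1
    start = record
      { blocks     = λ { zero → S p ; (suc zero) → T q }
      ; admissible = λ { zero → inj₁ (p , refl) ; (suc zero) → inj₂ (q , refl) }
      ; connected  = λ { zero → x , x∈p∩q⁺ (x∈Sp , x∈Tq) }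
      }

lemma7 : (n s t : ℕ) → 0 < n → 0 < s → 0 < t →
         (S : Fin s → Subset n) → (T : Fin t → Subset n) →
         (∀ p → Nonempty (S p)) →
         (∀ p p′ → p ≢ p′ → Empty (S p ∩ S p′)) →
         (∀ q → Nonempty (T q)) →
         (∀ q q′ → q ≢ q′ → Empty (T q ∩ T q′)) →
         ⋃[ ⊤ ] S ≡ ⊤ → ⋃[ ⊤ ] T ≡ ⊤ →
         (∀ (θ₁ : Subset s) (θ₂ : Subset t) (Γ : Subset n) →
            ⋃[ θ₁ ] S ≡ Γ → ⋃[ θ₂ ] T ≡ Γ → (Γ ≡ ⊥ ⊎ Γ ≡ ⊤)) →
         ∃[ m ] (m ≥ 1 × Σ (Fin (suc m) → Subset n) λ L →
            (∀ i → (∃[ p ] L i ≡ S p) ⊎ (∃[ q ] L i ≡ T q)) ×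
            ⋃[ ⊤ ] L ≡ ⊤ ×
            (∀ (p : Fin m) → Nonempty (prefixUnion L (inject₁ p) ∩ L (suc p))))
lemma7 n (suc s) t _ _ _ S T nonemptyS _ _ _ coverS coverT trivialCommonUnions =
  let m , 1≤m , C , union≡⊤ = spanning-chain zero (proj₂ (nonemptyS zero))
  in m , 1≤m , blocks C , admissible C , trans (⋃⊤≡prefixUnion-last m (blocks C)) union≡⊤ , connected C
  where open TwoCovers S T coverS coverT trivialCommonUnions
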